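{- Consider the construction of $F_0,F_1,\dots,F_q$ described in the context. (a) If $F_0$ is neither the directed path $P_2$ nor a directed star on at least three vertices (i.e. $r+r'\ge2$), then the construction can always be carried out: there exist $x_1,y_1\in A$ not lying in the same $P_2$-copy, and for every $2\le j\le q$ and every $F_{j-1}$ obtained by the construction, there exist $x_j,y_j\in A$ of which precisely one belongs to $B_j$. (b) Every digraph $F_q$ obtained by the construction is a directed tree.
   Context: A directed tree (forest) is a digraph whose underlying graph is a tree (forest); a directed star is an orientation of a star $K_{1,m}$ with arbitrary arc directions, and a directed $P_2$ is a single arc. For a vertex set $X$ of a digraph $H$, $N^-_H(X)$ is the set of in-neighbours of vertices of $X$, and $N_H[X]=\bigcup_{x\in X}(N^-_H[x]\cup N^+_H[x])$ (closed neighbourhood ignoring directions). Construction: let $F_0$ be a directed forest consisting of $r\ge0$ copies of the directed path $P_2$ with arcs $(v_{11},v_{12}),\dots,(v_{r1},v_{r2})$ and $r'\ge0$ directed stars $H_1,\dots,H_{r'}$, each of order at least $3$, with central vertices $u_1,\dots,u_{r'}$, where $r+r'\ge1$. Let $q=r+r'-1$ and $A=\{v_{i1},v_{i2}\}_{i=1}^r\cup\{u_i\}_{i=1}^{r'}$. $F_1$ is obtained from $F_0$ by adding a new vertex $w_1$ and arcs $(x_1,w_1),(y_1,w_1)$ for some $x_1,y_1\in A$ that are not vertices of the same $P_2$-copy. For $2\le j\le q$, $F_j$ is obtained from $F_{j-1}$ by adding a new vertex $w_j$ and two arcs $(x_j,w_j),(y_j,w_j)$ such that (i) $x_j,y_j\in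 A$, and (ii) precisely one of $x_j,y_j$ belongs to $B_j=N_{F_0}[N^-_{F_{j-1}}(\{w_1,\dots,w_{j-1}\})]$. -}

module Defs where

open import Data.Nat using (ℕ; zero; suc; _≤_)
open import Data.Fin using (Fin)
open import Data.Bool using (Bool; true; false)
open import Data.Product using (Σ; ∃; _×_; _,_)
open import Data.Sum using (_⊎_; inj₁; inj₂)
open import Data.Unit using (⊤)
open import Data.Empty using (⊥)
open import Data.Maybe using (Maybe; just; nothing)
open import Data.List using (List; []; _∷_; _++_; [_]; length)
open import Data.List.Relation.Unary.Linked using (Linked)
open import Data.List.Relation.Unary.Unique.Propositional using (Unique)
open import Relation.Nullary using (¬_)
open import Relation.Binary.PropositionalEquality using (_≡_; _≢_)
open import Relation.Binary.Construct.Closure.ReflexiveTransitive using (Star)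

record Digraph : Set₁ where
  field
    V   : Set
    Arc : V → V → Set

open Digraph public

Adj : (D : Digraph) → V D → V D → Set
Adj D x y = Arc D x y ⊎ Arc D y x

Connected : Digraph → Set
Connected D = ∀ x y → Star (Adj D) x y

HasCycle : Digraph → Set
HasCycle D = Σ (V D) λ v → Σ (List (V D)) λ vs →
  (2 ≤ length vs) × Unique (v ∷ vs) × Linked (Adj D) (v ∷ vs ++ [ v ])

IsDirectedTree : Digraph → Set
IsDirectedTree D = V D × Connected D × ¬ HasCycle D

InNbhd : (D : Digraph) → (V D → Set) → V D → Set
InNbhd D X v = Σ (V D) λ x → X x × Arc D v x

ClosedNbhd : (D : Digraph) → (V D → Set) → V D → Set
ClosedNbhd D X v = Σ (V D) λ x → X x × (v ≡ x ⊎ Arc D x v ⊎ Arc D v x)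

-- r copies of P₂ and r' directed stars; star k has centre u_k and m k leaves,
-- dir k t = true means arc (u_k , leaf) and false means arc (leaf , u_k).
record Base : Set where
  field
    r r' : ℕ
    m    : Fin r' → ℕ
    dir  : (k : Fin r') → Fin (m k) → Bool

open Base public

module _ (β : Base) where

  data V0 : Set where
    pv   : Fin (r β) → Bool → V0        -- pv i false = v_{i1}, pv i true = v_{i2}
    ctr  : Fin (r' β) → V0
    leaf : (k : Fin (r' β)) → Fin (m β k) → V0

  data Arc0 : V0 → V0 → Set where
    p2arc  : ∀ i → Arc0 (pv i false) (pv i true)
    outarc : ∀ k t → dir β k t ≡ true  → Arc0 (ctr k) (leaf k t)
    inarc  : ∀ k t → dir β k t ≡ false → Arc0 (leaf k t) (ctr k)

  F0 : Digraph
  F0 = record { V = V0 ; Arc = Arc0 }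

  A : Set
  A = (Fin (r β) × Bool) ⊎ Fin (r' β)

  emb : A → V0
  emb (inj₁ (i , b)) = pv i b
  emb (inj₂ k)       = ctr k

  SameP2 : A → A → Set
  SameP2 (inj₁ (i , _)) (inj₁ (j , _)) = i ≡ j
  SameP2 _ _ = ⊥

  data Seq : ℕ → Set where
    []  : Seq zero
    _▷_ : ∀ {n} → Seq n → A × A → Seq (suc n)

  -- the added vertices w₁ … wₙ (nothing = the most recently added one)
  W : ∀ {n} → Seq n → Set
  W []      = ⊥
  W (s ▷ _) = Maybe (W s)

  ArcW : ∀ {n} (s : Seq n) → V0 → W s → Set
  ArcW (s ▷ (x , y)) u nothing  = (u ≡ emb x) ⊎ (u ≡ emb y)
  ArcW (s ▷ _)       u (just w) = ArcW s u w

  ArcF : ∀ {n} (s : Seq n) → V0 ⊎ W s → V0 ⊎ W s → Set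
  ArcF s (inj₁ u) (inj₁ v) = Arc0 u v
  ArcF s (inj₁ u) (inj₂ w) = ArcW s u w
  ArcF s (inj₂ _) _        = ⊥

  F : ∀ {n} → Seq n → Digraph
  F s = record { V = V0 ⊎ W s ; Arc = ArcF s }

  IsW : ∀ {n} (s : Seq n) → V0 ⊎ W s → Set
  IsW s (inj₁ _) = ⊥
  IsW s (inj₂ _) = ⊤

  -- B_j = N_{F₀}[ N⁻_{F_{j-1}}({w₁,…,w_{j-1}}) ], where s gives F_{j-1}
  B : ∀ {n} → Seq n → V0 → Set
  B s = ClosedNbhd F0 (λ u → InNbhd (F s) (IsW s) (inj₁ u))

  ExactlyOne : (V0 → Set) → A → A → Set
  ExactlyOne P x y = (P (emb x) × ¬ P (emb y)) ⊎ (¬ P (emb x) × P (emb y))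

  -- first step: x₁ , y₁ ∈ A distinct (two arcs) and not in the same P₂-copy
  FirstOK : A → A → Set
  FirstOK x y = x ≢ y × ¬ SameP2 x y

  Valid : ∀ {n} → Seq n → Set
  Valid []                        = ⊤
  Valid ([] ▷ (x , y))            = FirstOK x y
  Valid ((s ▷ p) ▷ (x , y))       = Valid (s ▷ p) × ExactlyOne (B (s ▷ p)) x y

-- A component of F₀ is touched by a construction sequence once one of the
-- chosen vertices lies in it.  Since every component is a star around each of
-- its vertices in A, B_j is exactly the union of the touched components, so a
-- valid step j ≥ 2 joins one touched and one untouched component: after j
-- steps exactly j + 1 components are touched, and (a) follows by counting.
-- For (b), rank the vertices of F_q lexicographically: w_j gets (j, 0), and a
-- vertex of the component first touched at step j gets (j, 1) if it is the
-- vertex joined to w_j then and (j, 2) otherwise.  Adjacent vertices get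
-- different ranks and no vertex has two lower neighbours, which rules out
-- cycles; every vertex other than w₁ (or, if q = 0, a fixed vertex in A of the
-- only component) has a lower neighbour, so descending connects all vertices.

module Submission where

open import Defs
open import Data.Nat using (ℕ; suc; _+_; _∸_; _≤_)
open import Data.Fin using (Fin)
open import Data.Product using (Σ; _×_)

open import Data.Bool using (true; false)
import Data.Bool.Properties as Bool
open import Data.Empty using (⊥; ⊥-elim)
open import Data.Fin using (zero; suc)
open import Data.Fin.Properties using (+↔⊎; injective⇒≤; ¬∀⟶∃¬) renaming (_≟_ to _≟ᶠ_)
open import Data.List using (List; []; _∷_; _++_; [_])
open import Data.List.Membership.Propositional using (_∈_)
open import Data.List.Relation.Unary.All using (All; _∷_; lookup)
open import Data.List.Relation.Unary.AllPairs using (_∷_)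
open import Data.List.Relation.Unary.Any using (here; there)
open import Data.List.Relation.Unary.Linked using (Linked; [-]; _∷_)
open import Data.List.Relation.Unary.Unique.Propositional using (Unique)
open import Data.Maybe using (just; nothing)
open import Data.Nat using (zero; _<_; z≤n; s≤s)
open import Data.Nat.Induction using (<-wellFounded)
open import Data.Nat.Properties using (≤-refl; <-trans; <-irrefl; <-cmp; <⇒≤; <⇒≱; m≤n+m∸n)
open import Data.Product using (∃; _,_; proj₁; proj₂)
open import Data.Product.Relation.Binary.Lex.Strict using (×-Lex; ×-transitive; ×-wellFounded)
open import Data.Sum using (_⊎_; inj₁; inj₂; swap)
import Data.Sum as Sum
open import Data.Sum.Properties using (≡-dec)
open import Data.Unit using (⊤; tt)
open import Function using (_∘_)
open import Function.Bundles using (_⇔_; mk⇔; Equivalence; _↔_; Inverse; Injection)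
open import Function.Definitions using (Injective)
open import Function.Properties.Inverse using (↔⇒↣; ↔-sym)
open import Induction.WellFounded using (WellFounded; Acc; acc)
open import Level using (0ℓ)
open import Relation.Binary.Core using (Rel)
import Relation.Binary.Construct.On as On
open import Relation.Binary.Construct.Closure.ReflexiveTransitive using (Star; ε; _◅_; _◅◅_; reverse)
open import Relation.Binary.Definitions using (Transitive; Irreflexive; DecidableEquality; tri<; tri≈; tri>)
open import Relation.Binary.PropositionalEquality
  using (_≡_; _≢_; refl; sym; trans; cong; subst; subst₂; ≢-sym; isEquivalence; resp₂)
open import Relation.Nullary using (¬_; Dec; yes; no; _⊎-dec_)
open import Relation.Unary using (Decidable)

module RankedDigraph (D : Digraph) {ℓ} {_≺_ : Rel (V D) ℓ}
  (≺-trans : Transitive _≺_) (≺-irrefl : Irreflexive _≡_ _≺_)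
  (comparable : ∀ {x y} → Adj D x y → x ≺ y ⊎ y ≺ x)
  (lower-unique : ∀ {x y z} → Adj D x y → Adj D x z → y ≺ x → z ≺ x → y ≡ z)
  where

  ≺-asym : ∀ {x y} → x ≺ y → ¬ y ≺ x
  ≺-asym x≺y y≺x = ≺-irrefl refl (≺-trans x≺y y≺x)

  NonBacktracking : List (V D) → Set
  NonBacktracking (a ∷ b ∷ c ∷ xs) = a ≢ c × NonBacktracking (b ∷ c ∷ xs)
  NonBacktracking _ = ⊤

  lastOf : V D → List (V D) → V D
  lastOf a []       = a
  lastOf _ (b ∷ xs) = lastOf b xs

  lastOf-∈ : ∀ a xs → lastOf a xs ∈ a ∷ xs
  lastOf-∈ a []       = here refl
  lastOf-∈ _ (b ∷ xs) = there (lastOf-∈ b xs)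

  last-edge : ∀ a xs z → Linked (Adj D) (a ∷ xs ++ [ z ]) → Adj D (lastOf a xs) z
  last-edge a []       z (az ∷ _)   = az
  last-edge a (b ∷ xs) z (_ ∷ walk) = last-edge b xs z walk

  ascending-step : ∀ {a b c} → Adj D a b → Adj D b c → a ≢ c → a ≺ b → b ≺ c
  ascending-step ab bc a≢c a≺b with comparable bc
  ... | inj₁ b≺c = b≺c
  ... | inj₂ c≺b = ⊥-elim (a≢c (lower-unique (swap ab) bc a≺b c≺b))

  -- Once a non-backtracking walk goes up it keeps going up: the vertex it
  -- came from is the only lower neighbour of the current one.
  ascend : ∀ a b xs z → Linked (Adj D) (a ∷ b ∷ xs ++ [ z ]) →
           NonBacktracking (a ∷ b ∷ xs ++ [ z ]) → a ≺ b → a ≺ z × lastOf b xs ≺ z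
  ascend a b []       z (ab ∷ bz ∷ [-]) (a≢z , _) a≺b =
    let b≺z = ascending-step ab bz a≢z a≺b in ≺-trans a≺b b≺z , b≺z
  ascend a b (c ∷ xs) z (ab ∷ walk@(bc ∷ _)) (a≢c , nb) a≺b =
    let b≺c = ascending-step ab bc a≢c a≺b
        b≺z , last≺z = ascend b c xs z walk nb b≺c
    in ≺-trans a≺b b≺z , last≺z

  descend : ∀ a b xs z → Linked (Adj D) (a ∷ b ∷ xs ++ [ z ]) →
            NonBacktracking (a ∷ b ∷ xs ++ [ z ]) → z ≺ lastOf b xs → z ≺ a
  descend a b xs z walk@(ab ∷ walk′) nb z≺last with comparable ab
  ... | inj₁ a≺b = ⊥-elim (≺-asym z≺last (proj₂ (ascend a b xs z walk nb a≺b)))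
  descend a b []       z walk nb z≺b | inj₂ b≺a = ≺-trans z≺b b≺a
  descend a b (c ∷ xs) z (_ ∷ walk′) (_ , nb) z≺last | inj₂ b≺a =
    ≺-trans (descend b c xs z walk′ nb z≺last) b≺a

  unique-snoc⇒nonbacktracking : ∀ {v} ys → Unique ys → All (v ≢_) ys → NonBacktracking (ys ++ [ v ])
  unique-snoc⇒nonbacktracking []                 _ _               = tt
  unique-snoc⇒nonbacktracking (_ ∷ [])           _ _               = tt
  unique-snoc⇒nonbacktracking (_ ∷ _ ∷ [])       _ (v≢y ∷ _)       = ≢-sym v≢y , tt
  unique-snoc⇒nonbacktracking (y ∷ y′ ∷ y″ ∷ ys) ((_ ∷ y≢y″ ∷ _) ∷ u) (_ ∷ v∉) =
    y≢y″ , unique-snoc⇒nonbacktracking (y′ ∷ y″ ∷ ys) u v∉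

  cycle-nonbacktracking : ∀ {v y₁ y₂} ys → Unique (v ∷ y₁ ∷ y₂ ∷ ys) →
                          NonBacktracking (v ∷ y₁ ∷ y₂ ∷ ys ++ [ v ])
  cycle-nonbacktracking ys (v∉@(_ ∷ v≢y₂ ∷ _) ∷ u) = v≢y₂ , unique-snoc⇒nonbacktracking (_ ∷ _ ∷ ys) u v∉

  -- A cycle cannot leave its start v upwards, nor enter it downwards (it would
  -- then ascend, resp. descend, all the way); so both of its edges at v lead
  -- down, giving v two distinct lower neighbours.
  acyclic : ¬ HasCycle D
  acyclic (_ , []     , () , _)
  acyclic (_ , _ ∷ [] , s≤s () , _)
  acyclic (v , y₁ ∷ y₂ ∷ ys , _ , u@(_ ∷ y₁∉ ∷ _) , walk@(vy₁ ∷ walk′))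
    with comparable vy₁ | comparable (last-edge y₁ (y₂ ∷ ys) v walk′)
  ... | inj₁ v≺y₁ | _ =
    ≺-irrefl refl (proj₁ (ascend v y₁ (y₂ ∷ ys) v walk (cycle-nonbacktracking ys u) v≺y₁))
  ... | inj₂ _ | inj₂ v≺yₖ =
    ≺-irrefl refl (descend v y₁ (y₂ ∷ ys) v walk (cycle-nonbacktracking ys u) v≺yₖ)
  ... | inj₂ y₁≺v | inj₁ yₖ≺v =
    lookup y₁∉ (lastOf-∈ y₂ ys) (lower-unique vy₁ (swap (last-edge y₁ (y₂ ∷ ys) v walk′)) y₁≺v yₖ≺v)

module Descent (D : Digraph) {ℓ} {_≺_ : Rel (V D) ℓ} (≺-wellFounded : WellFounded _≺_)
  (Root : V D → Set) (descent : ∀ x → Root x ⊎ ∃ λ y → Adj D x y × y ≺ x)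
  where

  reaches-root : ∀ x → ∃ λ ρ → Root ρ × Star (Adj D) x ρ
  reaches-root x = go x (≺-wellFounded x)
    where
    go : ∀ x → Acc _≺_ x → ∃ λ ρ → Root ρ × Star (Adj D) x ρ
    go x (acc rec) with descent x
    ... | inj₁ root = x , root , ε
    ... | inj₂ (y , xy , y≺x) with go y (rec y≺x)
    ...   | ρ , root , path = ρ , root , xy ◅ path

  connected : (∀ {x y} → Root x → Root y → x ≡ y) → Connected D
  connected root-unique x y with reaches-root x | reaches-root y
  ... | ρ , root , path | ρ′ , root′ , path′ =
    path ◅◅ subst (λ t → Star (Adj D) t y) (root-unique root′ root) (reverse swap path′)

record Enumeration {X : Set} (P : X → Set) (size : ℕ) : Set where
  field
    enum           : Fin size → X
    enum-injective : Injective _≡_ _≡_ enum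
    enum-sound     : ∀ i → P (enum i)
    enum-complete  : ∀ {x} → P x → ∃ λ i → enum i ≡ x

open Enumeration

module _ {X : Set} where

  enumeration-∅ : Enumeration {X} (λ _ → ⊥) 0
  enumeration-∅ = record
    { enum = λ () ; enum-injective = λ {} ; enum-sound = λ () ; enum-complete = λ () }

  enumeration-resp : ∀ {P Q : X → Set} {size} →
                     (∀ {x} → P x ⇔ Q x) → Enumeration P size → Enumeration Q size
  enumeration-resp P⇔Q e = record
    { enum = enum e
    ; enum-injective = enum-injective e
    ; enum-sound = Equivalence.to P⇔Q ∘ enum-sound e
    ; enum-complete = enum-complete e ∘ Equivalence.from P⇔Q
    }

  enumeration-extend : ∀ {P : X → Set} {size c} → Enumeration P size → ¬ P c →
                       Enumeration (λ x → x ≡ c ⊎ P x) (suc size)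
  enumeration-extend {P} {size} {c} e ¬Pc = record
    { enum = enum′ ; enum-injective = injective ; enum-sound = sound ; enum-complete = complete }
    where
    enum′ : Fin (suc size) → X
    enum′ zero    = c
    enum′ (suc i) = enum e i

    injective : Injective _≡_ _≡_ enum′
    injective {zero}  {zero}  _  = refl
    injective {zero}  {suc j} eq = ⊥-elim (¬Pc (subst P (sym eq) (enum-sound e j)))
    injective {suc i} {zero}  eq = ⊥-elim (¬Pc (subst P eq (enum-sound e i)))
    injective {suc i} {suc j} eq = cong suc (enum-injective e eq)

    sound : ∀ i → enum′ i ≡ c ⊎ P (enum′ i)
    sound zero    = inj₁ refl
    sound (suc i) = inj₂ (enum-sound e i)

    complete : ∀ {x} → x ≡ c ⊎ P x → ∃ λ i → enum′ i ≡ x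
    complete (inj₁ refl) = zero , refl
    complete (inj₂ Px)   = let i , eq = enum-complete e Px in suc i , eq

module _ {X : Set} {N : ℕ} (fin : Fin N ↔ X) {P : X → Set} (P? : Decidable P) where
  open Inverse fin using (to; from)

  to-injective : Injective _≡_ _≡_ to
  to-injective = Injection.injective (↔⇒↣ fin)

  from-injective : Injective _≡_ _≡_ from
  from-injective = Injection.injective (↔⇒↣ (↔-sym fin))

  enumeration-missing : ∀ {size} → Enumeration P size → size < N → ∃ λ x → ¬ P x
  enumeration-missing {size} e size<N =
    let i , ¬P = ¬∀⟶∃¬ N (P ∘ to) (P? ∘ to) not-all in to i , ¬P
    where
    not-all : ¬ (∀ i → P (to i))
    not-all all = <⇒≱ size<N (injective⇒≤ index-injective)
      where
      index : Fin N → Fin size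
      index i = proj₁ (enum-complete e (all i))

      index-injective : Injective _≡_ _≡_ index
      index-injective {i} {j} eq = to-injective (trans (sym (proj₂ (enum-complete e (all i))))
                                   (trans (cong (enum e) eq) (proj₂ (enum-complete e (all j)))))

  enumeration-full : ∀ {size} → Enumeration P size → N ≤ size → ∀ x → P x
  enumeration-full {size} e N≤size x with P? x
  ... | yes Px = Px
  ... | no ¬Px = ⊥-elim (<⇒≱ (injective⇒≤ (enum-injective e′ ∘ from-injective)) N≤size)
    where e′ = enumeration-extend e ¬Px

module Construction (β : Base) where

  Component : Set
  Component = Fin (r β) ⊎ Fin (r' β)

  Fin↔Component : Fin (r β + r' β) ↔ Component
  Fin↔Component = +↔⊎

  _≟ᶜ_ : DecidableEquality Component
  _≟ᶜ_ = ≡-dec _≟ᶠ_ _≟ᶠ_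

  component : V0 β → Component
  component (pv i _)   = inj₁ i
  component (ctr k)    = inj₂ k
  component (leaf k _) = inj₂ k

  componentᴬ : A β → Component
  componentᴬ a = component (emb β a)

  representative : Component → A β
  representative (inj₁ i) = inj₁ (i , false)
  representative (inj₂ k) = inj₂ k

  component-representative : ∀ c → componentᴬ (representative c) ≡ c
  component-representative (inj₁ _) = refl
  component-representative (inj₂ _) = refl

  _≟₀_ : DecidableEquality (V0 β)
  pv i b ≟₀ pv j b′ with i ≟ᶠ j | b Bool.≟ b′
  ... | yes refl | yes refl = yes refl
  ... | no i≢j   | _        = no λ { refl → i≢j refl }
  ... | _        | no b≢b′  = no λ { refl → b≢b′ refl }
  ctr k ≟₀ ctr k′ with k ≟ᶠ k′
  ... | yes refl = yes refl
  ... | no k≢k′  = no λ { refl → k≢k′ refl }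
  leaf k t ≟₀ leaf k′ t′ with k ≟ᶠ k′
  ... | no k≢k′  = no λ { refl → k≢k′ refl }
  ... | yes refl with t ≟ᶠ t′
  ...   | yes refl = yes refl
  ...   | no t≢t′  = no λ { refl → t≢t′ refl }
  pv _ _   ≟₀ ctr _    = no λ ()
  pv _ _   ≟₀ leaf _ _ = no λ ()
  ctr _    ≟₀ pv _ _   = no λ ()
  ctr _    ≟₀ leaf _ _ = no λ ()
  leaf _ _ ≟₀ pv _ _   = no λ ()
  leaf _ _ ≟₀ ctr _    = no λ ()

  arc-component : ∀ {u u′} → Arc0 β u u′ → component u ≡ component u′
  arc-component (p2arc _)      = refl
  arc-component (outarc _ _ _) = refl
  arc-component (inarc _ _ _)  = refl

  arc-irreflexive : ∀ {u} → ¬ Arc0 β u u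
  arc-irreflexive ()

  arc-meets-A-vertex : ∀ a {u u′} → componentᴬ a ≡ component u → Arc0 β u u′ →
                       u ≡ emb β a ⊎ u′ ≡ emb β a
  arc-meets-A-vertex (inj₁ (_ , false)) refl (p2arc _)      = inj₁ refl
  arc-meets-A-vertex (inj₁ (_ , true))  refl (p2arc _)      = inj₂ refl
  arc-meets-A-vertex (inj₂ _)           refl (outarc _ _ _) = inj₁ refl
  arc-meets-A-vertex (inj₂ _)           refl (inarc _ _ _)  = inj₂ refl
  arc-meets-A-vertex (inj₂ _)           ()   (p2arc _)
  arc-meets-A-vertex (inj₁ _)           ()   (outarc _ _ _)
  arc-meets-A-vertex (inj₁ _)           ()   (inarc _ _ _)

  star-around : ∀ a {u} → componentᴬ a ≡ component u → u ≢ emb β a →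
                Arc0 β u (emb β a) ⊎ Arc0 β (emb β a) u
  star-around (inj₁ (i , false)) {pv .i false} refl u≢a = ⊥-elim (u≢a refl)
  star-around (inj₁ (i , false)) {pv .i true}  refl _   = inj₂ (p2arc i)
  star-around (inj₁ (i , true))  {pv .i false} refl _   = inj₁ (p2arc i)
  star-around (inj₁ (i , true))  {pv .i true}  refl u≢a = ⊥-elim (u≢a refl)
  star-around (inj₂ k) {ctr .k}    refl u≢a = ⊥-elim (u≢a refl)
  star-around (inj₂ k) {leaf .k t} refl _ with dir β k t in d
  ... | true  = inj₂ (outarc k t d)
  ... | false = inj₁ (inarc k t d)
  star-around (inj₁ _) {ctr _}    ()
  star-around (inj₁ _) {leaf _ _} ()
  star-around (inj₂ _) {pv _ _}   ()

  near-A-vertex : ∀ a {u} → componentᴬ a ≡ component u →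
                  u ≡ emb β a ⊎ Arc0 β (emb β a) u ⊎ Arc0 β u (emb β a)
  near-A-vertex a {u} same with u ≟₀ emb β a
  ... | yes u≡a = inj₁ u≡a
  ... | no u≢a  = inj₂ (swap (star-around a same u≢a))

  near⇒same-component : ∀ {u v} → v ≡ u ⊎ Arc0 β u v ⊎ Arc0 β v u → component u ≡ component v
  near⇒same-component (inj₁ refl)       = refl
  near⇒same-component (inj₂ (inj₁ uv)) = arc-component uv
  near⇒same-component (inj₂ (inj₂ vu)) = sym (arc-component vu)

  Touched : ∀ {n} → Seq β n → Component → Set
  Touched []            _ = ⊥
  Touched (s ▷ (x , y)) c = Touched s c ⊎ (c ≡ componentᴬ x ⊎ c ≡ componentᴬ y)

  touched? : ∀ {n} (s : Seq β n) → Decidable (Touched s)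
  touched? []            _ = no λ ()
  touched? (s ▷ (x , y)) c = touched? s c ⊎-dec (c ≟ᶜ componentᴬ x ⊎-dec c ≟ᶜ componentᴬ y)

  touched-after-step : ∀ {n} (s : Seq β n) x y {new} →
                       (∀ {c} → c ≡ new → c ≡ componentᴬ x ⊎ c ≡ componentᴬ y) →
                       (∀ {c} → c ≡ componentᴬ x ⊎ c ≡ componentᴬ y → c ≡ new ⊎ Touched s c) →
                       ∀ {c} → (c ≡ new ⊎ Touched s c) ⇔ Touched (s ▷ (x , y)) c
  touched-after-step s x y new-in-step step-in-new =
    mk⇔ Sum.[ inj₂ ∘ new-in-step , inj₁ ] Sum.[ inj₂ , step-in-new ]

  chooseIn : Component → A β → A β → A β
  chooseIn c x y with componentᴬ x ≟ᶜ c | componentᴬ y ≟ᶜ c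
  ... | yes _ | _     = x
  ... | no _  | yes _ = y
  ... | no _  | no _  = representative c

  -- (index of the step that first touched c, the vertex of c chosen then);
  -- junk values if c is untouched.
  attachment : ∀ {n} → Seq β n → Component → ℕ × A β
  attachment []                  c = 0 , representative c
  attachment (_▷_ {n} s (x , y)) c with touched? s c
  ... | yes _ = attachment s c
  ... | no _  = n , chooseIn c x y

  stage : ∀ {n} → Seq β n → Component → ℕ
  stage s c = proj₁ (attachment s c)

  anchor : ∀ {n} → Seq β n → Component → A β
  anchor s c = proj₂ (attachment s c)

  attachment-old : ∀ {n} (s : Seq β n) x y {c} → Touched s c →
                   attachment (s ▷ (x , y)) c ≡ attachment s c
  attachment-old s _ _ {c} t with touched? s c
  ... | yes _ = refl
  ... | no ¬t = ⊥-elim (¬t t)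

  attachment-new : ∀ {n} (s : Seq β n) x y {c} → ¬ Touched s c →
                   attachment (s ▷ (x , y)) c ≡ (n , chooseIn c x y)
  attachment-new s _ _ {c} ¬t with touched? s c
  ... | yes t = ⊥-elim (¬t t)
  ... | no _  = refl

  stage-old : ∀ {n} (s : Seq β n) x y {c} → Touched s c → stage (s ▷ (x , y)) c ≡ stage s c
  stage-old s x y t = cong proj₁ (attachment-old s x y t)

  anchor-old : ∀ {n} (s : Seq β n) x y {c} → Touched s c → anchor (s ▷ (x , y)) c ≡ anchor s c
  anchor-old s x y t = cong proj₂ (attachment-old s x y t)

  component-chooseIn : ∀ c x y → componentᴬ (chooseIn c x y) ≡ c
  component-chooseIn c x y with componentᴬ x ≟ᶜ c | componentᴬ y ≟ᶜ c
  ... | yes eq | _      = eq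
  ... | no _   | yes eq = eq
  ... | no _   | no _   = component-representative c

  chooseIn-x : ∀ {c} x y → componentᴬ x ≡ c → chooseIn c x y ≡ x
  chooseIn-x {c} x y eq with componentᴬ x ≟ᶜ c
  ... | yes _ = refl
  ... | no ne = ⊥-elim (ne eq)

  chooseIn-y : ∀ {c} x y → componentᴬ x ≢ c → componentᴬ y ≡ c → chooseIn c x y ≡ y
  chooseIn-y {c} x y ne eq with componentᴬ x ≟ᶜ c | componentᴬ y ≟ᶜ c
  ... | yes eq′ | _     = ⊥-elim (ne eq′)
  ... | no _    | yes _ = refl
  ... | no _    | no ne′ = ⊥-elim (ne′ eq)

  chooseIn-∈ : ∀ {c} x y → c ≡ componentᴬ x ⊎ c ≡ componentᴬ y →
               chooseIn c x y ≡ x ⊎ chooseIn c x y ≡ y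
  chooseIn-∈ {c} x y c∈xy with componentᴬ x ≟ᶜ c | componentᴬ y ≟ᶜ c
  ... | yes _ | _     = inj₁ refl
  ... | no _  | yes _ = inj₂ refl
  ... | no x∉ | no y∉ = ⊥-elim (Sum.[ x∉ ∘ sym , y∉ ∘ sym ] c∈xy)

  component-anchor : ∀ {n} (s : Seq β n) c → componentᴬ (anchor s c) ≡ c
  component-anchor []            c = component-representative c
  component-anchor (s ▷ (x , y)) c with touched? s c
  ... | yes _ = component-anchor s c
  ... | no _  = component-chooseIn c x y

  stage-touched : ∀ {n} (s : Seq β n) {c} → Touched s c → stage s c < n
  stage-touched (s ▷ (x , y)) {c} t with touched? s c
  ... | yes t′ = <-trans (stage-touched s t′) ≤-refl
  ... | no _   = ≤-refl

  stage≤length : ∀ {n} (s : Seq β n) x y c → stage (s ▷ (x , y)) c ≤ n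
  stage≤length s _ _ c with touched? s c
  ... | yes t = <⇒≤ (stage-touched s t)
  ... | no _  = ≤-refl

  idx : ∀ {n} {s : Seq β n} → W β s → ℕ
  idx {s = _▷_ {n} _ _} nothing  = n
  idx {s = _ ▷ _}       (just w) = idx w

  idx-< : ∀ {n} {s : Seq β n} (w : W β s) → idx w < n
  idx-< {s = _ ▷ _} nothing  = ≤-refl
  idx-< {s = _ ▷ _} (just w) = <-trans (idx-< w) ≤-refl

  idx-injective : ∀ {n} {s : Seq β n} → Injective _≡_ _≡_ (idx {s = s})
  idx-injective {s = _ ▷ _} {nothing} {nothing} _  = refl
  idx-injective {s = _ ▷ _} {nothing} {just w}  eq = ⊥-elim (<-irrefl (sym eq) (idx-< w))
  idx-injective {s = _ ▷ _} {just w}  {nothing} eq = ⊥-elim (<-irrefl eq (idx-< w))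
  idx-injective {s = _ ▷ _} {just w}  {just w′} eq = cong just (idx-injective eq)

  endpoint-touched : ∀ {n} (s : Seq β n) {u} w → ArcW β s u w → Touched s (component u)
  endpoint-touched (_ ▷ _) nothing  (inj₁ refl) = inj₂ (inj₁ refl)
  endpoint-touched (_ ▷ _) nothing  (inj₂ refl) = inj₂ (inj₂ refl)
  endpoint-touched (s ▷ _) (just w) arc         = inj₁ (endpoint-touched s w arc)

  anchor-attached : ∀ {n} (s : Seq β n) {c} → Touched s c →
                    Σ (W β s) λ w → idx w ≡ stage s c × ArcW β s (emb β (anchor s c)) w
  anchor-attached (s ▷ (x , y)) {c} (inj₁ t) rewrite attachment-old s x y t =
    let w , idx≡ , arc = anchor-attached s t in just w , idx≡ , arc
  anchor-attached (s ▷ (x , y)) {c} (inj₂ c∈xy) with touched? s c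
  ... | yes t = let w , idx≡ , arc = anchor-attached s t in just w , idx≡ , arc
  ... | no _  = nothing , refl , Sum.map (cong (emb β)) (cong (emb β)) (chooseIn-∈ x y c∈xy)

  stage≤idx : ∀ {n} (s : Seq β n) {u} w → ArcW β s u w → stage s (component u) ≤ idx w
  stage≤idx (s ▷ (x , y)) {u} nothing  _   = stage≤length s x y (component u)
  stage≤idx (s ▷ (x , y))     (just w) arc =
    subst (_≤ idx w) (sym (stage-old s x y (endpoint-touched s w arc))) (stage≤idx s w arc)

  B⇒touched : ∀ {n} (s : Seq β n) {v} → B β s v → Touched s (component v)
  B⇒touched s (_ , (inj₂ w , _ , arc) , near) =
    subst (Touched s) (near⇒same-component near) (endpoint-touched s w arc)

  touched⇒B : ∀ {n} (s : Seq β n) {v} → Touched s (component v) → B β s v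
  touched⇒B s {v} t =
    let w , _ , arc = anchor-attached s t
        a = anchor s (component v)
    in emb β a , (inj₂ w , tt , arc) , near-A-vertex a (component-anchor s (component v))

  exactlyOne-map : ∀ {P Q : V0 β → Set} {x y} → (∀ {v} → P v → Q v) → (∀ {v} → Q v → P v) →
                   ExactlyOne β P x y → ExactlyOne β Q x y
  exactlyOne-map P⇒Q Q⇒P (inj₁ (px , ¬py)) = inj₁ (P⇒Q px , ¬py ∘ Q⇒P)
  exactlyOne-map P⇒Q Q⇒P (inj₂ (¬px , py)) = inj₂ (¬px ∘ Q⇒P , P⇒Q py)

  valid-prefix : ∀ {n} (s : Seq β n) p → Valid β (s ▷ p) → Valid β s
  valid-prefix []      _ _       = tt
  valid-prefix (_ ▷ _) _ (ok , _) = ok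

  valid-step : ∀ {n} (s : Seq β n) p x y → Valid β ((s ▷ p) ▷ (x , y)) →
               ExactlyOne β (Touched (s ▷ p) ∘ component) x y
  valid-step s p _ _ (_ , one) =
    exactlyOne-map {P = B β (s ▷ p)} (B⇒touched (s ▷ p)) (touched⇒B (s ▷ p)) one

  FirstOK⇒components-differ : ∀ x y → FirstOK β x y → componentᴬ x ≢ componentᴬ y
  FirstOK⇒components-differ (inj₁ _) (inj₁ _) (_ , ¬same) refl = ¬same refl
  FirstOK⇒components-differ (inj₂ _) (inj₂ _) (x≢y , _)   refl = x≢y refl
  FirstOK⇒components-differ (inj₁ _) (inj₂ _) _ ()
  FirstOK⇒components-differ (inj₂ _) (inj₁ _) _ ()

  components-differ⇒FirstOK : ∀ x y → componentᴬ x ≢ componentᴬ y → FirstOK β x y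
  components-differ⇒FirstOK x y differ = differ ∘ cong componentᴬ , not-same x y differ
    where
    not-same : ∀ x y → componentᴬ x ≢ componentᴬ y → ¬ SameP2 β x y
    not-same (inj₁ _) (inj₁ _) differ i≡j = differ (cong inj₁ i≡j)
    not-same (inj₁ _) (inj₂ _) _ ()
    not-same (inj₂ _) (inj₁ _) _ ()
    not-same (inj₂ _) (inj₂ _) _ ()

  step-components-differ : ∀ {n} (s : Seq β n) x y → Valid β (s ▷ (x , y)) →
                           componentᴬ x ≢ componentᴬ y
  step-components-differ []      x y ok = FirstOK⇒components-differ x y ok
  step-components-differ (s ▷ p) x y ok eq with valid-step s p x y ok
  ... | inj₁ (tx , ¬ty) = ¬ty (subst (Touched (s ▷ p)) eq tx)
  ... | inj₂ (¬tx , ty) = ¬tx (subst (Touched (s ▷ p)) (sym eq) ty)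

  not-both-touched : ∀ {n} (s : Seq β n) x y → Valid β (s ▷ (x , y)) →
                     Touched s (componentᴬ x) → Touched s (componentᴬ y) → ⊥
  not-both-touched []      _ _ _  ()
  not-both-touched (s ▷ p) x y ok tx ty with valid-step s p x y ok
  ... | inj₁ (_ , ¬ty) = ¬ty ty
  ... | inj₂ (¬tx , _) = ¬tx tx

  touched-enumeration : ∀ {n} (s : Seq β (suc n)) → Valid β s →
                        Enumeration (Touched s) (suc (suc n))
  touched-enumeration ([] ▷ (x , y)) ok =
    enumeration-resp (mk⇔ to from)
      (enumeration-extend (enumeration-extend enumeration-∅ λ ())
                          Sum.[ FirstOK⇒components-differ x y ok , (λ ()) ])
    where
    to : ∀ {c} → c ≡ componentᴬ x ⊎ c ≡ componentᴬ y ⊎ ⊥ → Touched ([] ▷ (x , y)) c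
    to (inj₁ eq)        = inj₂ (inj₁ eq)
    to (inj₂ (inj₁ eq)) = inj₂ (inj₂ eq)

    from : ∀ {c} → Touched ([] ▷ (x , y)) c → c ≡ componentᴬ x ⊎ c ≡ componentᴬ y ⊎ ⊥
    from (inj₂ (inj₁ eq)) = inj₁ eq
    from (inj₂ (inj₂ eq)) = inj₂ (inj₁ eq)
  touched-enumeration ((s ▷ p) ▷ (x , y)) ok with valid-step s p x y ok
  ... | inj₁ (tx , ¬ty) =
    enumeration-resp (touched-after-step (s ▷ p) x y inj₂
                        Sum.[ (λ { refl → inj₂ tx }) , inj₁ ])
                     (enumeration-extend (touched-enumeration (s ▷ p) (proj₁ ok)) ¬ty)
  ... | inj₂ (¬tx , ty) =
    enumeration-resp (touched-after-step (s ▷ p) x y inj₁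
                        Sum.[ inj₁ , (λ { refl → inj₂ ty }) ])
                     (enumeration-extend (touched-enumeration (s ▷ p) (proj₁ ok)) ¬tx)

  first-pair : 2 ≤ r β + r' β → Σ (A β) λ x → Σ (A β) λ y → FirstOK β x y
  first-pair 2≤N
    with enumeration-missing Fin↔Component (λ _ → no λ ()) enumeration-∅ (<-trans (s≤s z≤n) 2≤N)
  ... | c₀ , _ with enumeration-missing Fin↔Component (λ c → c ≟ᶜ c₀ ⊎-dec no λ ())
                      (enumeration-extend enumeration-∅ λ ()) 2≤N
  ...   | c₁ , c₁∉ = representative c₀ , representative c₁ , components-differ⇒FirstOK _ _ differ
    where
    differ : componentᴬ (representative c₀) ≢ componentᴬ (representative c₁)
    differ eq = c₁∉ (inj₁ (subst₂ _≡_ (component-representative c₁) (component-representative c₀) (sym eq)))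

  next-pair : ∀ {n} (s : Seq β (suc n)) → Valid β s → suc (suc n) < r β + r' β →
              Σ (A β) λ x → Σ (A β) λ y → ExactlyOne β (B β s) x y
  next-pair s@(_ ▷ (x , _)) ok lt
    with enumeration-missing Fin↔Component (touched? s) (touched-enumeration s ok) lt
  ... | c , ¬t = x , representative c ,
        inj₁ (touched⇒B s (inj₂ (inj₁ refl)) , ¬t ∘ subst (Touched s) (component-representative c) ∘ B⇒touched s)

  stage-<-length⇒touched : ∀ {n} (s : Seq β n) x y {c} → stage (s ▷ (x , y)) c < n → Touched s c
  stage-<-length⇒touched s _ _ {c} lt with touched? s c
  ... | yes t = t
  ... | no _  = ⊥-elim (<-irrefl refl lt)

  stage-length⇒untouched : ∀ {n} (s : Seq β n) x y {c} → stage (s ▷ (x , y)) c ≡ n → ¬ Touched s c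
  stage-length⇒untouched s x y eq t = <-irrefl (trans (sym (stage-old s x y t)) eq) (stage-touched s t)

  anchor-new : ∀ {n} (s : Seq β n) x y {c} → ¬ Touched s c → anchor (s ▷ (x , y)) c ≡ chooseIn c x y
  anchor-new s x y ¬t = cong proj₂ (attachment-new s x y ¬t)

  earlier-endpoints-equal : ∀ {n} (s : Seq β n) → Valid β s → ∀ {u u′} w → ArcW β s u w → ArcW β s u′ w →
                            stage s (component u) < idx w → stage s (component u′) < idx w → u ≡ u′
  earlier-endpoints-equal (s ▷ (x , y)) ok nothing arc arc′ lt lt′ =
    same arc arc′ (stage-<-length⇒touched s x y lt) (stage-<-length⇒touched s x y lt′)
    where
    same : ∀ {u u′} → ArcW β (s ▷ (x , y)) u nothing → ArcW β (s ▷ (x , y)) u′ nothing →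
           Touched s (component u) → Touched s (component u′) → u ≡ u′
    same (inj₁ refl) (inj₁ refl) _  _  = refl
    same (inj₂ refl) (inj₂ refl) _  _  = refl
    same (inj₁ refl) (inj₂ refl) tx ty = ⊥-elim (not-both-touched s x y ok tx ty)
    same (inj₂ refl) (inj₁ refl) ty tx = ⊥-elim (not-both-touched s x y ok tx ty)
  earlier-endpoints-equal (s ▷ (x , y)) ok (just w) arc arc′ lt lt′ =
    earlier-endpoints-equal s (valid-prefix s _ ok) w arc arc′
      (subst (_< idx w) (stage-old s x y (endpoint-touched s w arc)) lt)
      (subst (_< idx w) (stage-old s x y (endpoint-touched s w arc′)) lt′)

  endpoint-at-stage-is-anchor : ∀ {n} (s : Seq β n) → Valid β s → ∀ {u} w → ArcW β s u w →
                                stage s (component u) ≡ idx w → u ≡ emb β (anchor s (component u))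
  endpoint-at-stage-is-anchor (s ▷ (x , y)) ok nothing (inj₁ refl) eq =
    cong (emb β) (sym (trans (anchor-new s x y (stage-length⇒untouched s x y eq)) (chooseIn-x x y refl)))
  endpoint-at-stage-is-anchor (s ▷ (x , y)) ok nothing (inj₂ refl) eq =
    cong (emb β) (sym (trans (anchor-new s x y (stage-length⇒untouched s x y eq))
                             (chooseIn-y x y (step-components-differ s x y ok) refl)))
  endpoint-at-stage-is-anchor (s ▷ (x , y)) ok (just w) arc eq =
    trans (endpoint-at-stage-is-anchor s (valid-prefix s _ ok) w arc (trans (sym (stage-old s x y t)) eq))
          (cong (emb β) (sym (anchor-old s x y t)))
    where t = endpoint-touched s w arc

  earlier-endpoint : ∀ {n} (s : Seq β n) → Valid β s → ∀ w → 0 < idx w →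
                     ∃ λ u → ArcW β s u w × stage s (component u) < idx w
  earlier-endpoint ([] ▷ _) _ nothing ()
  earlier-endpoint ((s ▷ q) ▷ (x , y)) ok nothing _ with valid-step s q x y ok
  ... | inj₁ (tx , _) =
    emb β x , inj₁ refl , subst (_< _) (sym (stage-old (s ▷ q) x y tx)) (stage-touched (s ▷ q) tx)
  ... | inj₂ (_ , ty) =
    emb β y , inj₂ refl , subst (_< _) (sym (stage-old (s ▷ q) x y ty)) (stage-touched (s ▷ q) ty)
  earlier-endpoint (s ▷ (x , y)) ok (just w) pos with earlier-endpoint s (valid-prefix s _ ok) w pos
  ... | u , arc , lt = u , arc , subst (_< idx w) (sym (stage-old s x y (endpoint-touched s w arc))) lt

  module Ranking {n} (s : Seq β n) (ok : Valid β s) where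

    level : A β → V0 β → ℕ
    level a u with u ≟₀ emb β a
    ... | yes _ = 1
    ... | no _  = 2

    level-A : ∀ a → level a (emb β a) ≡ 1
    level-A a with emb β a ≟₀ emb β a
    ... | yes _ = refl
    ... | no ne = ⊥-elim (ne refl)

    level-other : ∀ {a u} → u ≢ emb β a → level a u ≡ 2
    level-other {a} {u} ne with u ≟₀ emb β a
    ... | yes eq = ⊥-elim (ne eq)
    ... | no _   = refl

    level-positive : ∀ a u → 0 < level a u
    level-positive a u with u ≟₀ emb β a
    ... | yes _ = s≤s z≤n
    ... | no _  = s≤s z≤n

    level-< : ∀ {a u u′} → level a u < level a u′ → u ≡ emb β a × u′ ≢ emb β a
    level-< {a} {u} {u′} lt with u ≟₀ emb β a | u′ ≟₀ emb β a
    ... | yes eq | no ne = eq , ne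
    ... | yes _  | yes _ = ⊥-elim (<-irrefl refl lt)
    ... | no _   | yes _ = ⊥-elim (<⇒≱ lt (s≤s z≤n))
    ... | no _   | no _  = ⊥-elim (<-irrefl refl lt)

    vertexKey : Component → V0 β → ℕ × ℕ
    vertexKey c u = stage s c , level (anchor s c) u

    key : V (F β s) → ℕ × ℕ
    key (inj₁ u) = vertexKey (component u) u
    key (inj₂ w) = idx w , 0

    _<ₗₑₓ_ : Rel (ℕ × ℕ) 0ℓ
    _<ₗₑₓ_ = ×-Lex _≡_ _<_ _<_

    _≺_ : Rel (V (F β s)) 0ℓ
    x ≺ y = key x <ₗₑₓ key y

    ≺-trans : Transitive _≺_
    ≺-trans {x} {y} {z} =
      ×-transitive {_<₂_ = _<_} isEquivalence (resp₂ _<_) <-trans <-trans {key x} {key y} {key z}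

    ≺-irrefl : Irreflexive _≡_ _≺_
    ≺-irrefl refl (inj₁ lt)       = <-irrefl refl lt
    ≺-irrefl refl (inj₂ (_ , lt)) = <-irrefl refl lt

    ≺-wellFounded : WellFounded _≺_
    ≺-wellFounded = On.wellFounded key (×-wellFounded <-wellFounded <-wellFounded)

    key-in : ∀ {u c} → component u ≡ c → key (inj₁ u) ≡ vertexKey c u
    key-in {u} = cong (λ c → vertexKey c u)

    anchor-below : ∀ {c v t} → component v ≡ c → component t ≡ c →
                   v ≡ emb β (anchor s c) → t ≢ emb β (anchor s c) → inj₁ v ≺ inj₁ t
    anchor-below {c} {v} {t} cv ct v≡a t≢a =
      subst₂ _<ₗₑₓ_ (sym (key-in cv)) (sym (key-in ct)) (inj₂ (refl , levels))
      where
      levels : level (anchor s c) v < level (anchor s c) t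
      levels = subst₂ _<_ (sym (trans (cong (level _) v≡a) (level-A _))) (sym (level-other t≢a)) (s≤s (s≤s z≤n))

    ≺-in-component : ∀ {c v t} → component v ≡ c → component t ≡ c → inj₁ v ≺ inj₁ t →
                     v ≡ emb β (anchor s c) × t ≢ emb β (anchor s c)
    ≺-in-component cv ct lt with subst₂ _<ₗₑₓ_ (key-in cv) (key-in ct) lt
    ... | inj₁ st<st      = ⊥-elim (<-irrefl refl st<st)
    ... | inj₂ (_ , l<l′) = level-< l<l′

    adjacent-component : ∀ {u u′} → Arc0 β u u′ ⊎ Arc0 β u′ u → component u′ ≡ component u
    adjacent-component = Sum.[ sym ∘ arc-component , arc-component ]

    comparable-arc : ∀ {u u′} → Arc0 β u u′ → inj₁ u ≺ inj₁ u′ ⊎ inj₁ u′ ≺ inj₁ u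
    comparable-arc {u} {u′} arc
      with arc-meets-A-vertex (anchor s (component u)) (component-anchor s _) arc
    ... | inj₁ u≡a  = inj₁ (anchor-below refl (sym (arc-component arc)) u≡a
                              (λ u′≡a → arc-irreflexive (subst₂ (Arc0 β) u≡a u′≡a arc)))
    ... | inj₂ u′≡a = inj₂ (anchor-below (sym (arc-component arc)) refl u′≡a
                              (λ u≡a → arc-irreflexive (subst₂ (Arc0 β) u≡a u′≡a arc)))

    comparable-added : ∀ u w → inj₁ u ≺ inj₂ w ⊎ inj₂ w ≺ inj₁ u
    comparable-added u w with <-cmp (stage s (component u)) (idx w)
    ... | tri< lt _ _ = inj₁ (inj₁ lt)
    ... | tri≈ _ eq _ = inj₂ (inj₂ (sym eq , level-positive _ u))
    ... | tri> _ _ gt = inj₂ (inj₁ gt)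

    comparable : ∀ {x y} → Adj (F β s) x y → x ≺ y ⊎ y ≺ x
    comparable {inj₁ _} {inj₁ _} (inj₁ arc) = comparable-arc arc
    comparable {inj₁ _} {inj₁ _} (inj₂ arc) = swap (comparable-arc arc)
    comparable {inj₁ u} {inj₂ w} _          = comparable-added u w
    comparable {inj₂ w} {inj₁ u} _          = swap (comparable-added u w)
    comparable {inj₂ _} {inj₂ _} (inj₁ ())
    comparable {inj₂ _} {inj₂ _} (inj₂ ())

    lower-of-anchor : ∀ {u y} → u ≡ emb β (anchor s (component u)) → Adj (F β s) (inj₁ u) y →
                      y ≺ inj₁ u → Σ (W β s) λ w → y ≡ inj₂ w × idx w ≡ stage s (component u)
    lower-of-anchor {y = inj₁ _} u≡a adj lt =
      ⊥-elim (proj₂ (≺-in-component (adjacent-component adj) refl lt) u≡a)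
    lower-of-anchor {y = inj₂ w} _ (inj₁ arc) (inj₁ idx<stage)     = ⊥-elim (<⇒≱ idx<stage (stage≤idx s w arc))
    lower-of-anchor {y = inj₂ w} _ (inj₁ arc) (inj₂ (idx≡stage , _)) = w , refl , idx≡stage
    lower-of-anchor {y = inj₂ _} _ (inj₂ ()) _

    lower-of-other : ∀ {u y} → u ≢ emb β (anchor s (component u)) → Adj (F β s) (inj₁ u) y →
                     y ≺ inj₁ u → y ≡ inj₁ (emb β (anchor s (component u)))
    lower-of-other {y = inj₁ _} _ adj lt =
      cong inj₁ (proj₁ (≺-in-component (adjacent-component adj) refl lt))
    lower-of-other {y = inj₂ w} _ (inj₁ arc) (inj₁ idx<stage) = ⊥-elim (<⇒≱ idx<stage (stage≤idx s w arc))
    lower-of-other {y = inj₂ w} u≢a (inj₁ arc) (inj₂ (idx≡stage , _)) =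
      ⊥-elim (u≢a (endpoint-at-stage-is-anchor s ok w arc (sym idx≡stage)))
    lower-of-other {y = inj₂ _} _ (inj₂ ()) _

    lower-of-added : ∀ {w y} → Adj (F β s) (inj₂ w) y → y ≺ inj₂ w →
                     Σ (V0 β) λ u → y ≡ inj₁ u × ArcW β s u w × stage s (component u) < idx w
    lower-of-added {y = inj₁ u} (inj₂ arc) (inj₁ lt)      = u , refl , arc , lt
    lower-of-added {y = inj₁ _} (inj₂ _)   (inj₂ (_ , ()))
    lower-of-added {y = inj₁ _} (inj₁ ())  _
    lower-of-added {y = inj₂ _} (inj₁ ())  _
    lower-of-added {y = inj₂ _} (inj₂ ())  _

    lower-unique : ∀ {x y z} → Adj (F β s) x y → Adj (F β s) x z → y ≺ x → z ≺ x → y ≡ z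
    lower-unique {inj₁ u} {y} {z} xy xz y≺x z≺x = by-anchor (u ≟₀ emb β (anchor s (component u)))
      where
      by-anchor : Dec (u ≡ emb β (anchor s (component u))) → y ≡ z
      by-anchor (no u≢a) = trans (lower-of-other u≢a xy y≺x) (sym (lower-of-other u≢a xz z≺x))
      by-anchor (yes u≡a) with lower-of-anchor u≡a xy y≺x | lower-of-anchor u≡a xz z≺x
      ... | w , y≡w , idx≡ | w′ , z≡w′ , idx≡′ =
        trans y≡w (trans (cong inj₂ (idx-injective (trans idx≡ (sym idx≡′)))) (sym z≡w′))
    lower-unique {inj₂ w} {y} {z} xy xz y≺x z≺x
      with lower-of-added {y = y} xy y≺x | lower-of-added {y = z} xz z≺x
    ... | u , refl , arc , lt | u′ , refl , arc′ , lt′ =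
      cong inj₁ (earlier-endpoints-equal s ok w arc arc′ lt lt′)

    data Root : V (F β s) → Set where
      first-added       : ∀ {w} → idx w ≡ 0 → Root (inj₂ w)
      unattached-anchor : ∀ {c} → ¬ Touched s c → Root (inj₁ (emb β (anchor s c)))

    descent : ∀ x → Root x ⊎ ∃ λ y → Adj (F β s) x y × y ≺ x
    descent (inj₂ w) = by-index (idx w) refl
      where
      by-index : ∀ k → idx w ≡ k → Root (inj₂ w) ⊎ ∃ λ y → Adj (F β s) (inj₂ w) y × y ≺ inj₂ w
      by-index zero    idx≡ = inj₁ (first-added idx≡)
      by-index (suc _) idx≡ =
        let u , arc , lt = earlier-endpoint s ok w (subst (0 <_) (sym idx≡) (s≤s z≤n))
        in inj₂ (inj₁ u , inj₂ arc , inj₁ lt)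
    descent (inj₁ u) = by-anchor (u ≟₀ emb β a) (touched? s (component u))
      where
      a = anchor s (component u)
      Descends = Root (inj₁ u) ⊎ ∃ λ y → Adj (F β s) (inj₁ u) y × y ≺ inj₁ u

      by-anchor : Dec (u ≡ emb β a) → Dec (Touched s (component u)) → Descends
      by-anchor (no u≢a) _ =
        inj₂ (inj₁ (emb β a) , star-around a (component-anchor s _) u≢a ,
              anchor-below (component-anchor s _) refl refl u≢a)
      by-anchor (yes u≡a) (no ¬t) = inj₁ (subst Root (cong inj₁ (sym u≡a)) (unattached-anchor ¬t))
      by-anchor (yes u≡a) (yes t) =
        let w , idx≡ , arc = anchor-attached s t in
        inj₂ (inj₂ w , inj₁ (subst (λ v → ArcW β s v w) (sym u≡a) arc) , inj₂ (idx≡ , level-positive _ u))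

    acyclic : ¬ HasCycle (F β s)
    acyclic = RankedDigraph.acyclic (F β s) {_≺_ = _≺_}
      (λ {x y z} → ≺-trans {x} {y} {z}) ≺-irrefl (λ {x y} → comparable {x} {y})
      (λ {x y z} → lower-unique {x} {y} {z})

    connected : (∀ {x y} → Root x → Root y → x ≡ y) → Connected (F β s)
    connected = Descent.connected (F β s) {_≺_ = _≺_} ≺-wellFounded Root descent

  construction-is-tree : ∀ {n} (s : Seq β n) → Valid β s → 1 ≤ r β + r' β → r β + r' β ≤ suc n →
                         IsDirectedTree (F β s)
  construction-is-tree [] ok 1≤N N≤1
    with enumeration-missing Fin↔Component (λ _ → no λ ()) enumeration-∅ 1≤N
  ... | c₀ , _ = inj₁ (emb β (representative c₀)) , connected root-unique , acyclic
    where
    open Ranking [] ok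

    only-c₀ : ∀ c → c ≡ c₀ ⊎ ⊥
    only-c₀ = enumeration-full Fin↔Component (λ c → c ≟ᶜ c₀ ⊎-dec no λ ())
                (enumeration-extend enumeration-∅ λ ()) N≤1

    root-unique : ∀ {x y} → Root x → Root y → x ≡ y
    root-unique (first-added {()} _)
    root-unique (unattached-anchor {c} _) (first-added {()} _)
    root-unique (unattached-anchor {c} _) (unattached-anchor {c′} _) =
      cong (λ c → inj₁ (emb β (anchor [] c))) (trans (same c) (sym (same c′)))
      where
      same : ∀ c → c ≡ c₀
      same c = Sum.fromInj₁ (λ ()) (only-c₀ c)
  construction-is-tree (s ▷ p) ok _ N≤ = inj₂ nothing , connected root-unique , acyclic
    where
    open Ranking (s ▷ p) ok

    all-touched : ∀ c → Touched (s ▷ p) c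
    all-touched = enumeration-full Fin↔Component (touched? (s ▷ p)) (touched-enumeration (s ▷ p) ok) N≤

    root-unique : ∀ {x y} → Root x → Root y → x ≡ y
    root-unique (first-added idx≡) (first-added idx≡′) = cong inj₂ (idx-injective (trans idx≡ (sym idx≡′)))
    root-unique (unattached-anchor ¬t) _ = ⊥-elim (¬t (all-touched _))
    root-unique _ (unattached-anchor ¬t) = ⊥-elim (¬t (all-touched _))

open Construction

proposition3 : (β : Base) → (∀ k → 2 ≤ m β k) → 1 ≤ r β + r' β →
    ((2 ≤ r β + r' β →
        (Σ (A β) λ x → Σ (A β) λ y → FirstOK β x y)
        × (∀ (n : ℕ) (s : Seq β (suc n)) → suc (suc n) ≤ r β + r' β ∸ 1 → Valid β s →
             Σ (A β) λ x → Σ (A β) λ y → ExactlyOne β (B β s) x y))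
    × (∀ (s : Seq β (r β + r' β ∸ 1)) → Valid β s → IsDirectedTree (F β s)))
proposition3 β _ 1≤N =
  (λ 2≤N → first-pair β 2≤N , λ _ s lt ok → next-pair β s ok (≤-pred⇒< lt)) ,
  (λ s ok → construction-is-tree β s ok 1≤N (m≤n+m∸n _ 1))
  where
  ≤-pred⇒< : ∀ {k N} → suc k ≤ N ∸ 1 → suc k < N
  ≤-pred⇒< {N = suc _} lt = s≤s lt
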